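{- Let $\alpha,\beta,\gamma,x\in\mathbb{N}_0$ with $(\alpha,\beta,\gamma,x)\neq(0,0,0,0)$ and let $\lambda\in\mathbb{N}_0$. Then for every integer $n\ge 0$, $$A^{\lambda,x}_{n+1}(\alpha,\beta,\gamma)=\gamma\, A^{\lambda,x}_n(\alpha,\beta,\gamma+\alpha)+x\lambda\beta\, A^{\lambda+1,x}_n(\alpha,\beta,\gamma+\beta+\alpha).$$
   Context: For a number $\alpha$ and integer $n\ge0$, $(t|\alpha)_n=t(t-\alpha)(t-2\alpha)\cdots(t-(n-1)\alpha)$, with $(t|\alpha)_0=1$. For numbers $\alpha,\beta,\gamma$ the generalised Stirling numbers $S(n,k,\alpha,\beta,\gamma)$, $0\le k\le n$, are defined by the polynomial identity in $t$: $(t|\alpha)_n=\sum_{k=0}^{n}S(n,k,\alpha,\beta,\gamma)\,(t-\gamma|\beta)_k$. For a number $\lambda$ and integer $k\ge0$, $\binom{k+\lambda-1}{k}=\lambda(\lambda+1)\cdots(\lambda+k-1)/k!$ (equal to $1$ for $k=0$). Define $$A^{\lambda,x}_n(\alpha,\beta,\gamma)=\sum_{k=0}^{n}\binom{k+\lambda-1}{k}(-1)^{n+k}\beta^k k!\,S(n,k,\alpha,-\beta,-\gamma)\,x^k.$$ For $\alpha\neq0$ these numbers have exponential generating function $\sum_{n\ge0}A^{\lambda,x}_n(\alpha,\beta,\gamma)\frac{t^n}{n!}=(1-\alpha t)^{ -\gamma/\alpha}\bigl[1-x((1-\alpha t)^{ -\beta/\alpha}-1)\bigr]^{ -\lambda}$.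 -}

module Defs where

open import Data.Nat as ℕ using (ℕ; zero; suc; _∸_; _!)
open import Data.Nat.Combinatorics using (_C_)
open import Data.Integer using (ℤ; +_; -_; _+_; _-_; _*_; _^_)

-- Generalised falling factorial (t|α)_n = t(t-α)...(t-(n-1)α) over ℤ.
fall : ℤ → ℤ → ℕ → ℤ
fall t a zero    = + 1
fall t a (suc n) = fall t a n * (t - (+ n) * a)

-- Generalised Stirling numbers S(n,k,α,β,γ), the connection coefficients in
--   (t|α)_n = Σ_{k=0}^n S(n,k,α,β,γ) (t-γ|β)_k ,
-- computed by the triangular recurrence obtained from
--   (t|α)_{n+1} = (t|α)_n (t - nα),  t - nα = (t-γ-kβ) + (kβ+γ-nα):
--   S(0,0)=1, S(0,k+1)=0,
--   S(n+1,k) = S(n,k-1) + (kβ + γ - nα) S(n,k).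
-- Entries with k > n are 0.
S : ℕ → ℕ → ℤ → ℤ → ℤ → ℤ
S zero    zero    a b c = + 1
S zero    (suc k) a b c = + 0
S (suc n) zero    a b c = (c - (+ n) * a) * S n zero a b c
S (suc n) (suc k) a b c =
  S n k a b c + ((+ suc k) * b + c - (+ n) * a) * S n (suc k) a b c

sumTo : ℕ → (ℕ → ℤ) → ℤ
sumTo zero    f = f zero
sumTo (suc n) f = sumTo n f + f (suc n)

-- binom(k+λ-1, k) = λ(λ+1)...(λ+k-1)/k! for λ ∈ ℕ
-- (for λ = 0 this is 1 if k = 0 and 0 otherwise, which (k ∸ 1) C k gives).
multiChoose : ℕ → ℕ → ℕ
multiChoose lam k = (k ℕ.+ lam ∸ 1) C k

sgn : ℕ → ℤ
sgn m = (- (+ 1)) ^ m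

A : ℕ → ℕ → ℤ → ℤ → ℤ → ℤ → ℤ
A n lam x a b c =
  sumTo n (λ k → (+ multiChoose lam k) * sgn (n ℕ.+ k) * (b ^ k) * (+ (k !))
                   * S n k a (- b) (- c) * (x ^ k))

{-# OPTIONS --safe #-}
-- Shifting t by α, the falling factorial factors from the front: (t + α | α)_{n+1} = (t + α) (t | α)_n.
-- Splitting t + α = (γ + α) + (t − γ) and expanding (t | α)_n in the basis (t − γ | β)_k for the
-- first summand and in (t − γ − β | β)_k for the second, where (t − γ)(t − γ − β | β)_k = (t − γ | β)_{k+1},
-- gives the first-step recurrence
--   S(n+1, k, α, β, γ+α) = (γ+α) S(n, k, α, β, γ) + S(n, k−1, α, β, γ+β),
-- which also follows by induction on n from the defining one. Substituted into A_{n+1} term by term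
-- (with β, γ negated, the sign (−1)^{n+k} absorbing the minus), the first part sums to γ A_n(γ+α);
-- in the second, the absorption identity (k+1) binom(k+λ, k+1) = λ binom(k+λ, k) turns the weight of
-- index k+1 for λ into xλβ times the weight of index k for λ+1, which sums to xλβ A^{λ+1}_n(γ+β+α).
module Submission where

open import Defs
open import Data.Nat using (ℕ; suc)
open import Data.Integer using (ℤ; +_; _+_; _*_)
open import Data.Product using (_×_)
open import Relation.Nullary using (¬_)
open import Relation.Binary.PropositionalEquality using (_≡_)

open import Data.Nat as ℕ using (zero; _<_; s≤s; _!)
import Data.Nat.Properties as ℕₚ
open import Data.Nat.Combinatorics using (_C_; nC1≡n; nCk+nC[k+1]≡[n+1]C[k+1])
import Data.Nat.Tactic.RingSolver as ℕ-Solver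
open import Data.Integer using (-_; _-_; _^_)
import Data.Integer.Properties as ℤₚ
open import Data.Integer.Tactic.RingSolver using (solve-∀)
open import Relation.Binary.PropositionalEquality using (refl; trans; cong; cong₂; module ≡-Reasoning)

open ≡-Reasoning

sumTo-decompose : ∀ n c d (f g h : ℕ → ℤ) →
  g zero ≡ c * f zero → (∀ k → g (suc k) ≡ c * f (suc k) + d * h k) →
  sumTo (suc n) g ≡ c * sumTo (suc n) f + d * sumTo n h
sumTo-decompose zero c d f g h g₀ gₛ =
  trans (cong₂ _+_ g₀ (gₛ zero)) (regroup c d (f 0) (f 1) (h 0))
  where
  regroup : ∀ c d u v w → c * u + (c * v + d * w) ≡ c * (u + v) + d * w
  regroup = solve-∀
sumTo-decompose (suc n) c d f g h g₀ gₛ =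
  trans (cong₂ _+_ (sumTo-decompose n c d f g h g₀ gₛ) (gₛ (suc n)))
        (regroup c d (sumTo (suc n) f) (sumTo n h) (f (suc (suc n))) (h (suc n)))
  where
  regroup : ∀ c d F H u w → (c * F + d * H) + (c * u + d * w) ≡ c * (F + u) + d * (H + w)
  regroup = solve-∀

[1+k]*nC[1+k]+k*nCk≡n*nCk : ∀ n k → suc k ℕ.* (n C suc k) ℕ.+ k ℕ.* (n C k) ≡ n ℕ.* (n C k)
[1+k]*nC[1+k]+k*nCk≡n*nCk zero    zero    = refl
[1+k]*nC[1+k]+k*nCk≡n*nCk zero    (suc k) = cong₂ ℕ._+_ (ℕₚ.*-zeroʳ (suc (suc k))) (ℕₚ.*-zeroʳ (suc k))
[1+k]*nC[1+k]+k*nCk≡n*nCk (suc n) zero    = begin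
  1 ℕ.* (suc n C 1) ℕ.+ 0 ≡⟨ ℕₚ.+-identityʳ _ ⟩
  1 ℕ.* (suc n C 1)       ≡⟨ ℕₚ.*-identityˡ _ ⟩
  suc n C 1               ≡⟨ nC1≡n (suc n) ⟩
  suc n                   ≡⟨ ℕₚ.*-identityʳ (suc n) ⟨
  suc n ℕ.* 1             ∎
[1+k]*nC[1+k]+k*nCk≡n*nCk (suc n) (suc k) = begin
  (2 ℕ.+ k) ℕ.* (suc n C suc (suc k)) ℕ.+ (1 ℕ.+ k) ℕ.* (suc n C suc k)
    ≡⟨ cong₂ (λ u v → (2 ℕ.+ k) ℕ.* u ℕ.+ (1 ℕ.+ k) ℕ.* v) (pascal (suc k)) (pascal k) ⟨
  (2 ℕ.+ k) ℕ.* (c₁ ℕ.+ c₂) ℕ.+ (1 ℕ.+ k) ℕ.* (c₀ ℕ.+ c₁)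
    ≡⟨ split k c₀ c₁ c₂ ⟩
  ((2 ℕ.+ k) ℕ.* c₂ ℕ.+ (1 ℕ.+ k) ℕ.* c₁) ℕ.+ ((1 ℕ.+ k) ℕ.* c₁ ℕ.+ k ℕ.* c₀) ℕ.+ c₁ ℕ.+ c₀
    ≡⟨ cong₂ (λ u v → u ℕ.+ v ℕ.+ c₁ ℕ.+ c₀) ([1+k]*nC[1+k]+k*nCk≡n*nCk n (suc k)) ([1+k]*nC[1+k]+k*nCk≡n*nCk n k) ⟩
  n ℕ.* c₁ ℕ.+ n ℕ.* c₀ ℕ.+ c₁ ℕ.+ c₀
    ≡⟨ merge n c₀ c₁ ⟩
  (1 ℕ.+ n) ℕ.* (c₀ ℕ.+ c₁)
    ≡⟨ cong (suc n ℕ.*_) (pascal k) ⟩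
  (1 ℕ.+ n) ℕ.* (suc n C suc k)
    ∎
  where
  c₀ = n C k
  c₁ = n C suc k
  c₂ = n C suc (suc k)
  pascal : ∀ j → n C j ℕ.+ n C suc j ≡ suc n C suc j
  pascal = nCk+nC[k+1]≡[n+1]C[k+1] n
  split : ∀ k c₀ c₁ c₂ → (2 ℕ.+ k) ℕ.* (c₁ ℕ.+ c₂) ℕ.+ (1 ℕ.+ k) ℕ.* (c₀ ℕ.+ c₁)
        ≡ ((2 ℕ.+ k) ℕ.* c₂ ℕ.+ (1 ℕ.+ k) ℕ.* c₁) ℕ.+ ((1 ℕ.+ k) ℕ.* c₁ ℕ.+ k ℕ.* c₀) ℕ.+ c₁ ℕ.+ c₀
  split = ℕ-Solver.solve-∀
  merge : ∀ n c₀ c₁ → n ℕ.* c₁ ℕ.+ n ℕ.* c₀ ℕ.+ c₁ ℕ.+ c₀ ≡ (1 ℕ.+ n) ℕ.* (c₀ ℕ.+ c₁)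
  merge = ℕ-Solver.solve-∀

[1+k]*multiChoose[λ,1+k]≡λ*multiChoose[1+λ,k] : ∀ lam k →
  suc k ℕ.* multiChoose lam (suc k) ≡ lam ℕ.* multiChoose (suc lam) k
[1+k]*multiChoose[λ,1+k]≡λ*multiChoose[1+λ,k] lam k = begin
  suc k ℕ.* (m C suc k)   ≡⟨ ℕₚ.+-cancelʳ-≡ (k ℕ.* (m C k)) _ _ absorption ⟩
  lam ℕ.* (m C k)         ≡⟨ cong (λ t → lam ℕ.* ((t ℕ.∸ 1) C k)) (ℕₚ.+-suc k lam) ⟨
  lam ℕ.* multiChoose (suc lam) k ∎
  where
  m = k ℕ.+ lam
  absorption : suc k ℕ.* (m C suc k) ℕ.+ k ℕ.* (m C k) ≡ lam ℕ.* (m C k) ℕ.+ k ℕ.* (m C k)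
  absorption = begin
    suc k ℕ.* (m C suc k) ℕ.+ k ℕ.* (m C k) ≡⟨ [1+k]*nC[1+k]+k*nCk≡n*nCk m k ⟩
    m ℕ.* (m C k)                             ≡⟨ ℕₚ.*-distribʳ-+ (m C k) k lam ⟩
    k ℕ.* (m C k) ℕ.+ lam ℕ.* (m C k)         ≡⟨ ℕₚ.+-comm (k ℕ.* (m C k)) (lam ℕ.* (m C k)) ⟩
    lam ℕ.* (m C k) ℕ.+ k ℕ.* (m C k)         ∎

coeff : ℕ → ℕ → ℤ → ℤ → ℤ → ℤ
coeff n k a b c = (+ k) * b + c - (+ n) * a

S-above-diagonal : ∀ {n k} a b c → n < k → S n k a b c ≡ + 0
S-above-diagonal {zero}  {suc k} a b c _         = refl
S-above-diagonal {suc n} {suc k} a b c (s≤s n<k) = begin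
  S n k a b c + d * S n (suc k) a b c
    ≡⟨ cong₂ (λ u v → u + d * v) (S-above-diagonal a b c n<k)
                                 (S-above-diagonal a b c (ℕₚ.m<n⇒m<1+n n<k)) ⟩
  + 0 + d * + 0 ≡⟨ ℤₚ.+-identityˡ (d * + 0) ⟩
  d * + 0       ≡⟨ ℤₚ.*-zeroʳ d ⟩
  + 0           ∎
  where d = coeff n (suc k) a b c

c+a-[1+n]a≡c-na : ∀ n a c → c + a - (+ suc n) * a ≡ c - (+ n) * a
c+a-[1+n]a≡c-na n a c rewrite ℤₚ.pos-+ 1 n = shift (+ n) a c
  where
  shift : ∀ n a c → c + a - (+ 1 + n) * a ≡ c - n * a
  shift = solve-∀

coeff-shiftᵃ : ∀ n k a b c → coeff (suc n) k a b (c + a) ≡ coeff n k a b c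
coeff-shiftᵃ n k a b c = begin
  (+ k) * b + (c + a) - (+ suc n) * a ≡⟨ cong (_- (+ suc n) * a) (ℤₚ.+-assoc ((+ k) * b) c a) ⟨
  (+ k) * b + c + a - (+ suc n) * a   ≡⟨ c+a-[1+n]a≡c-na n a ((+ k) * b + c) ⟩
  (+ k) * b + c - (+ n) * a           ∎

coeff-shiftᵇ : ∀ n k a b c → coeff n (suc k) a b c ≡ coeff n k a b (c + b)
coeff-shiftᵇ n k a b c rewrite ℤₚ.pos-+ 1 k = shift (+ k) (+ n) a b c
  where
  shift : ∀ k n a b c → (+ 1 + k) * b + c - n * a ≡ k * b + (c + b) - n * a
  shift = solve-∀

S-shift-zero : ∀ n a b c → S (suc n) zero a b (c + a) ≡ (c + a) * S n zero a b c
S-shift-zero zero    a b c = base c a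
  where
  base : ∀ c a → (c + a - (+ 0) * a) * + 1 ≡ (c + a) * + 1
  base = solve-∀
S-shift-zero (suc n) a b c = begin
  (c + a - (+ suc n) * a) * S (suc n) zero a b (c + a)
    ≡⟨ cong₂ _*_ (c+a-[1+n]a≡c-na n a c) (S-shift-zero n a b c) ⟩
  (c - (+ n) * a) * ((c + a) * S n zero a b c)
    ≡⟨ swap (c - (+ n) * a) (c + a) (S n zero a b c) ⟩
  (c + a) * ((c - (+ n) * a) * S n zero a b c)
    ∎
  where
  swap : ∀ x y z → x * (y * z) ≡ y * (x * z)
  swap = solve-∀

x+d*0≡e*0+x : ∀ x d e → x + d * + 0 ≡ e * + 0 + x
x+d*0≡e*0+x = solve-∀

S-shift-suc : ∀ n k a b c →
  S (suc n) (suc k) a b (c + a) ≡ (c + a) * S n (suc k) a b c + S n k a b (c + b)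
S-shift-suc zero zero    a b c = x+d*0≡e*0+x (+ 1) (coeff 0 1 a b (c + a)) (c + a)
S-shift-suc zero (suc k) a b c = x+d*0≡e*0+x (+ 0) (coeff 0 (suc (suc k)) a b (c + a)) (c + a)
S-shift-suc (suc n) zero a b c = begin
  S (suc n) zero a b (c + a) + coeff (suc n) 1 a b (c + a) * S (suc n) 1 a b (c + a)
    ≡⟨ cong₂ (λ u v → u + coeff (suc n) 1 a b (c + a) * v)
             (S-shift-zero n a b c) (S-shift-suc n zero a b c) ⟩
  (c + a) * P + coeff (suc n) 1 a b (c + a) * ((c + a) * Q + V)
    ≡⟨ cong (λ d → (c + a) * P + d * ((c + a) * Q + V)) (coeff-shiftᵃ n 1 a b c) ⟩
  (c + a) * P + coeff n 1 a b c * ((c + a) * Q + V)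
    ≡⟨ regroup (c + a) P Q V (+ n) a b c ⟩
  (c + a) * (P + coeff n 1 a b c * Q) + (c + b - (+ n) * a) * V
    ∎
  where
  P = S n zero a b c
  Q = S n 1 a b c
  V = S n zero a b (c + b)
  regroup : ∀ e P Q V n a b c →
    e * P + ((+ 1) * b + c - n * a) * (e * Q + V)
      ≡ e * (P + ((+ 1) * b + c - n * a) * Q) + (c + b - n * a) * V
  regroup = solve-∀
S-shift-suc (suc n) (suc j) a b c = begin
  S (suc n) (suc j) a b (c + a) + coeff (suc n) k a b (c + a) * S (suc n) k a b (c + a)
    ≡⟨ cong₂ (λ u v → u + coeff (suc n) k a b (c + a) * v)
             (S-shift-suc n j a b c) (S-shift-suc n (suc j) a b c) ⟩
  (c + a) * P + U + coeff (suc n) k a b (c + a) * ((c + a) * Q + V)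
    ≡⟨ cong (λ d → (c + a) * P + U + d * ((c + a) * Q + V)) (coeff-shiftᵃ n k a b c) ⟩
  (c + a) * P + U + coeff n k a b c * ((c + a) * Q + V)
    ≡⟨ regroup (c + a) P U Q V (coeff n k a b c) ⟩
  (c + a) * (P + coeff n k a b c * Q) + (U + coeff n k a b c * V)
    ≡⟨ cong (λ d → (c + a) * (P + coeff n k a b c * Q) + (U + d * V)) (coeff-shiftᵇ n (suc j) a b c) ⟩
  (c + a) * (P + coeff n k a b c * Q) + (U + coeff n (suc j) a b (c + b) * V)
    ∎
  where
  k = suc (suc j)
  P = S n (suc j) a b c
  U = S n j a b (c + b)
  Q = S n k a b c
  V = S n (suc j) a b (c + b)
  regroup : ∀ e P U Q V d → e * P + U + d * (e * Q + V) ≡ e * (P + d * Q) + (U + d * V)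
  regroup = solve-∀

-[c+a]+a≡-c : ∀ c a → - (c + a) + a ≡ - c
-[c+a]+a≡-c = solve-∀

-[c+a]+-b≡-[c+b+a] : ∀ c a b → - (c + a) + - b ≡ - (c + b + a)
-[c+a]+-b≡-[c+b+a] = solve-∀

S-shift-zero⁻ : ∀ n a b c → S (suc n) zero a (- b) (- c) ≡ (- c) * S n zero a (- b) (- (c + a))
S-shift-zero⁻ n a b c = begin
  S (suc n) zero a (- b) (- c)
    ≡⟨ cong (S (suc n) zero a (- b)) (-[c+a]+a≡-c c a) ⟨
  S (suc n) zero a (- b) (- (c + a) + a)
    ≡⟨ S-shift-zero n a (- b) (- (c + a)) ⟩
  (- (c + a) + a) * S n zero a (- b) (- (c + a))
    ≡⟨ cong (_* S n zero a (- b) (- (c + a))) (-[c+a]+a≡-c c a) ⟩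
  (- c) * S n zero a (- b) (- (c + a))
    ∎

S-shift-suc⁻ : ∀ n k a b c → S (suc n) (suc k) a (- b) (- c)
  ≡ (- c) * S n (suc k) a (- b) (- (c + a)) + S n k a (- b) (- (c + b + a))
S-shift-suc⁻ n k a b c = begin
  S (suc n) (suc k) a (- b) (- c)
    ≡⟨ cong (S (suc n) (suc k) a (- b)) (-[c+a]+a≡-c c a) ⟨
  S (suc n) (suc k) a (- b) (- (c + a) + a)
    ≡⟨ S-shift-suc n k a (- b) (- (c + a)) ⟩
  (- (c + a) + a) * S n (suc k) a (- b) (- (c + a)) + S n k a (- b) (- (c + a) + - b)
    ≡⟨ cong₂ (λ e e′ → e * S n (suc k) a (- b) (- (c + a)) + S n k a (- b) e′)
             (-[c+a]+a≡-c c a) (-[c+a]+-b≡-[c+b+a] c a b) ⟩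
  (- c) * S n (suc k) a (- b) (- (c + a)) + S n k a (- b) (- (c + b + a))
    ∎

A-term : ℕ → ℕ → ℤ → ℤ → ℤ → ℤ → ℕ → ℤ
A-term n lam x a b c k =
  (+ multiChoose lam k) * sgn (n ℕ.+ k) * (b ^ k) * (+ (k !)) * S n k a (- b) (- c) * (x ^ k)

weight : ℕ → ℤ → ℤ → ℕ → ℤ
weight lam x b k = (+ multiChoose lam k) * b ^ k * (+ (k !)) * x ^ k

A-term-factor : ∀ n lam x a b c k →
  A-term n lam x a b c k ≡ sgn (n ℕ.+ k) * weight lam x b k * S n k a (- b) (- c)
A-term-factor n lam x a b c k =
  reorder (+ multiChoose lam k) (sgn (n ℕ.+ k)) (b ^ k) (+ (k !)) (S n k a (- b) (- c)) (x ^ k)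
  where
  reorder : ∀ m s B f σ X → m * s * B * f * σ * X ≡ s * (m * B * f * X) * σ
  reorder = solve-∀

weight-suc : ∀ lam x b k → weight lam x b (suc k) ≡ x * + lam * b * weight (suc lam) x b k
weight-suc lam x b k = begin
  m * (b * B) * (+ (suc k ℕ.* k !)) * (x * X)
    ≡⟨ cong (λ f → m * (b * B) * f * (x * X)) (ℤₚ.pos-* (suc k) (k !)) ⟩
  m * (b * B) * (+ suc k * + (k !)) * (x * X)
    ≡⟨ pull-out m b B (+ suc k) (+ (k !)) x X ⟩
  x * b * ((+ suc k * m) * B * + (k !) * X)
    ≡⟨ cong (λ t → x * b * (t * B * + (k !) * X)) absorption ⟩
  x * b * ((+ lam * m′) * B * + (k !) * X)
    ≡⟨ regroup x b (+ lam) m′ B (+ (k !)) X ⟩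
  x * + lam * b * (m′ * B * + (k !) * X)
    ∎
  where
  m  = + multiChoose lam (suc k)
  m′ = + multiChoose (suc lam) k
  B  = b ^ k
  X  = x ^ k
  absorption : + suc k * m ≡ + lam * m′
  absorption = begin
    + suc k * m                               ≡⟨ ℤₚ.pos-* (suc k) _ ⟨
    + (suc k ℕ.* multiChoose lam (suc k))     ≡⟨ cong +_ ([1+k]*multiChoose[λ,1+k]≡λ*multiChoose[1+λ,k] lam k) ⟩
    + (lam ℕ.* multiChoose (suc lam) k)       ≡⟨ ℤₚ.pos-* lam _ ⟩
    + lam * m′                                ∎
  pull-out : ∀ m b B K f x X → m * (b * B) * (K * f) * (x * X) ≡ x * b * ((K * m) * B * f * X)
  pull-out = solve-∀
  regroup : ∀ x b L m′ B f X → x * b * ((L * m′) * B * f * X) ≡ x * L * b * (m′ * B * f * X)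
  regroup = solve-∀

A-term-shift-zero : ∀ n lam x a b c →
  A-term (suc n) lam x a b c zero ≡ c * A-term n lam x a b (c + a) zero
A-term-shift-zero n lam x a b c = begin
  A-term (suc n) lam x a b c zero
    ≡⟨ A-term-factor (suc n) lam x a b c zero ⟩
  (- + 1 * s) * w * S (suc n) zero a (- b) (- c)
    ≡⟨ cong ((- + 1 * s) * w *_) (S-shift-zero⁻ n a b c) ⟩
  (- + 1 * s) * w * ((- c) * σ)
    ≡⟨ regroup c s w σ ⟩
  c * (s * w * σ)
    ≡⟨ cong (c *_) (A-term-factor n lam x a b (c + a) zero) ⟨
  c * A-term n lam x a b (c + a) zero
    ∎
  where
  s = sgn (n ℕ.+ zero)
  w = weight lam x b zero
  σ = S n zero a (- b) (- (c + a))
  regroup : ∀ c s w σ → (- + 1 * s) * w * ((- c) * σ) ≡ c * (s * w * σ)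
  regroup = solve-∀

A-term-shift-suc : ∀ n lam x a b c k →
  A-term (suc n) lam x a b c (suc k)
    ≡ c * A-term n lam x a b (c + a) (suc k) + x * + lam * b * A-term n (suc lam) x a b (c + b + a) k
A-term-shift-suc n lam x a b c k = begin
  A-term (suc n) lam x a b c (suc k)
    ≡⟨ A-term-factor (suc n) lam x a b c (suc k) ⟩
  (- + 1 * s′) * w′ * S (suc n) (suc k) a (- b) (- c)
    ≡⟨ cong ((- + 1 * s′) * w′ *_) (S-shift-suc⁻ n k a b c) ⟩
  (- + 1 * s′) * w′ * ((- c) * σ₁ + σ₂)
    ≡⟨ distribute c s′ w′ σ₁ σ₂ ⟩
  c * (s′ * w′ * σ₁) + (- + 1 * s′) * w′ * σ₂
    ≡⟨ cong₂ (λ t u → c * (s′ * w′ * σ₁) + (- + 1 * t) * u * σ₂)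
             (cong sgn (ℕₚ.+-suc n k)) (weight-suc lam x b k) ⟩
  c * (s′ * w′ * σ₁) + (- + 1 * (- + 1 * s)) * (x * + lam * b * w) * σ₂
    ≡⟨ regroup (c * (s′ * w′ * σ₁)) (x * + lam * b) s w σ₂ ⟩
  c * (s′ * w′ * σ₁) + x * + lam * b * (s * w * σ₂)
    ≡⟨ cong₂ (λ t u → c * t + x * + lam * b * u)
             (A-term-factor n lam x a b (c + a) (suc k))
             (A-term-factor n (suc lam) x a b (c + b + a) k) ⟨
  c * A-term n lam x a b (c + a) (suc k) + x * + lam * b * A-term n (suc lam) x a b (c + b + a) k
    ∎
  where
  s  = sgn (n ℕ.+ k)
  s′ = sgn (n ℕ.+ suc k)
  w  = weight (suc lam) x b k
  w′ = weight lam x b (suc k)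
  σ₁ = S n (suc k) a (- b) (- (c + a))
  σ₂ = S n k a (- b) (- (c + b + a))
  distribute : ∀ c s w σ₁ σ₂ → (- + 1 * s) * w * ((- c) * σ₁ + σ₂) ≡ c * (s * w * σ₁) + (- + 1 * s) * w * σ₂
  distribute = solve-∀
  regroup : ∀ u y s w σ → u + (- + 1 * (- + 1 * s)) * (y * w) * σ ≡ u + y * (s * w * σ)
  regroup = solve-∀

A-term-above-diagonal : ∀ n lam x a b c → A-term n lam x a b c (suc n) ≡ + 0
A-term-above-diagonal n lam x a b c = begin
  A-term n lam x a b c (suc n)
    ≡⟨ A-term-factor n lam x a b c (suc n) ⟩
  sgn (n ℕ.+ suc n) * weight lam x b (suc n) * S n (suc n) a (- b) (- c)
    ≡⟨ cong (sgn (n ℕ.+ suc n) * weight lam x b (suc n) *_) (S-above-diagonal a (- b) (- c) (ℕₚ.n<1+n n)) ⟩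
  sgn (n ℕ.+ suc n) * weight lam x b (suc n) * + 0
    ≡⟨ ℤₚ.*-zeroʳ (sgn (n ℕ.+ suc n) * weight lam x b (suc n)) ⟩
  + 0
    ∎

A-recurrence : ∀ n lam x a b c →
  A (suc n) lam x a b c ≡ c * A n lam x a b (c + a) + x * + lam * b * A n (suc lam) x a b (c + b + a)
A-recurrence n lam x a b c = begin
  A (suc n) lam x a b c
    ≡⟨ sumTo-decompose n c (x * + lam * b) (A-term n lam x a b (c + a)) (A-term (suc n) lam x a b c)
         (A-term n (suc lam) x a b (c + b + a))
         (A-term-shift-zero n lam x a b c) (A-term-shift-suc n lam x a b c) ⟩
  c * (A n lam x a b (c + a) + A-term n lam x a b (c + a) (suc n)) + x * + lam * b * A n (suc lam) x a b (c + b + a)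
    ≡⟨ cong (λ t → c * (A n lam x a b (c + a) + t) + x * + lam * b * A n (suc lam) x a b (c + b + a))
            (A-term-above-diagonal n lam x a b (c + a)) ⟩
  c * (A n lam x a b (c + a) + + 0) + x * + lam * b * A n (suc lam) x a b (c + b + a)
    ≡⟨ cong (λ t → c * t + x * + lam * b * A n (suc lam) x a b (c + b + a)) (ℤₚ.+-identityʳ _) ⟩
  c * A n lam x a b (c + a) + x * + lam * b * A n (suc lam) x a b (c + b + a)
    ∎

-- The recurrence holds for all integer parameters.
mainTheorem1 : (α β γ x lam : ℕ) →
    ¬ (α ≡ 0 × β ≡ 0 × γ ≡ 0 × x ≡ 0) →
    (n : ℕ) →
      A (suc n) lam (+ x) (+ α) (+ β) (+ γ)
        ≡ (+ γ) * A n lam (+ x) (+ α) (+ β) (+ γ + + α)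
          + (+ x) * (+ lam) * (+ β) * A n (suc lam) (+ x) (+ α) (+ β) (+ γ + + β + + α)
mainTheorem1 α β γ x lam _ n = A-recurrence n lam (+ x) (+ α) (+ β) (+ γ)
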